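{- Let $\mathcal A=\langle A;\Xi\rangle$ be an algebra where $\Xi$ contains a semigroup operation $\cdot$. Every cancellable finite index $\mathcal A$-stable preorder $\preceq$ coincides with its associated congruence $\sim=\{(x,y): x\preceq y\text{ and }y\preceq x\}$.
   Context: An $\mathcal A$-stable preorder is a reflexive transitive relation compatible with every operation in $\Xi$ (arguments pairwise related imply values related). A stable preorder $\preceq$ is cancellable (w.r.t. the semigroup operation) if $xz\preceq yz$ implies $x\preceq y$ and $zx\preceq zy$ implies $x\preceq y$. Its index is the number of classes of the associated congruence $\sim$. -}

module Defs where

open import Data.Nat using (ℕ)
open import Data.Fin using (Fin)
open import Data.Product using (Σ; _×_)
open import Relation.Binary.PropositionalEquality using (_≡_)

-- An algebra ⟨A; Ξ⟩ whose set of operations Ξ contains a semigroup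
-- operation _∙_ .  Ξ = { op i | i : Op } ∪ { _∙_ }, each op i finitary
-- of arity (arity i), taking its arguments as a function Fin (arity i) → A.
record SemigroupAlgebra : Set₁ where
  field
    Carrier : Set
    Op      : Set
    arity   : Op → ℕ
    op      : (i : Op) → (Fin (arity i) → Carrier) → Carrier
    _∙_     : Carrier → Carrier → Carrier
    ∙-assoc : ∀ x y z → ((x ∙ y) ∙ z) ≡ (x ∙ (y ∙ z))

module _ (𝒜 : SemigroupAlgebra) where
  open SemigroupAlgebra 𝒜

  record IsPreorderRel (_≼_ : Carrier → Carrier → Set) : Set where
    field
      refl  : ∀ x → x ≼ x
      trans : ∀ {x y z} → x ≼ y → y ≼ z → x ≼ z

  record IsStable (_≼_ : Carrier → Carrier → Set) : Set where
    field
      preorder : IsPreorderRel _≼_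
      op-mono  : ∀ (i : Op) (xs ys : Fin (arity i) → Carrier) →
                 (∀ k → xs k ≼ ys k) → op i xs ≼ op i ys
      ∙-mono   : ∀ {x y u v} → x ≼ y → u ≼ v → (x ∙ u) ≼ (y ∙ v)

  IsCancellable : (Carrier → Carrier → Set) → Set
  IsCancellable _≼_ =
    (∀ x y z → (x ∙ z) ≼ (y ∙ z) → x ≼ y) ×
    (∀ x y z → (z ∙ x) ≼ (z ∙ y) → x ≼ y)

  Assoc~ : (Carrier → Carrier → Set) → Carrier → Carrier → Set
  Assoc~ _≼_ x y = (x ≼ y) × (y ≼ x)

  -- finite index: the congruence ~ has finitely many classes, i.e. there
  -- are finitely many representatives r 0 … r (n-1) meeting every class
  FiniteIndex : (Carrier → Carrier → Set) → Set
  FiniteIndex _≼_ =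
    Σ ℕ λ n → Σ (Fin n → Carrier) λ r → ∀ x → Σ (Fin n) λ k → Assoc~ _≼_ x (r k)

{-# OPTIONS --safe #-}
-- Since ≼ is stable and cancellable, the quotient by ~ is a finite cancellative
-- semigroup, hence a group: by pigeonhole two powers a^i ~ a^j (i < j) coincide
-- and cancelling a^i makes a^(j-i) an identity. In this preordered group, if
-- x ≼ y then the identity e = x x⁻¹ lies below h = y x⁻¹, so
-- h ≼ h² ≼ … ≼ h^K ~ e, i.e. y x⁻¹ ≼ x x⁻¹, and cancelling x⁻¹ gives y ≼ x.
-- Everything is done modulo ~, without forming the quotient.
module Submission where

open import Algebra.Definitions using (Identity)
open import Data.Fin using (toℕ)
open import Data.Fin.Properties using (pigeonhole)
open import Data.Nat using (ℕ; zero; suc; _+_)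
open import Data.Nat.Properties using (+-comm; n<1+n; m≤n⇒∃[o]m+o≡n)
open import Data.Product using (_×_; _,_; proj₁; proj₂; ∃-syntax)
open import Relation.Binary.Bundles using (Preorder)
open import Relation.Binary.Structures using (IsEquivalence)
open import Relation.Binary.PropositionalEquality
  using (_≡_; refl; sym; trans; cong; subst)

open import Defs

module _ (𝒜 : SemigroupAlgebra) where
  open SemigroupAlgebra 𝒜 renaming (_∙_ to infixl 7 _∙_)

  infix 30 _^[1+_]

  _^[1+_] : Carrier → ℕ → Carrier
  a ^[1+ zero  ] = a
  a ^[1+ suc n ] = a ∙ a ^[1+ n ]

  ^[1+]-homo-∙ : ∀ a i j → a ^[1+ suc (i + j) ] ≡ a ^[1+ i ] ∙ a ^[1+ j ]
  ^[1+]-homo-∙ a zero    j = refl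
  ^[1+]-homo-∙ a (suc i) j =
    trans (cong (a ∙_) (^[1+]-homo-∙ a i j)) (sym (∙-assoc a (a ^[1+ i ]) (a ^[1+ j ])))

  module CancellablePreorder
    (_≼_ : Carrier → Carrier → Set)
    (≼-isPreorder : IsPreorderRel 𝒜 _≼_)
    (∙-mono : ∀ {x y u v} → x ≼ y → u ≼ v → (x ∙ u) ≼ (y ∙ v))
    (cancellable : IsCancellable 𝒜 _≼_)
    where

    open IsPreorderRel ≼-isPreorder renaming (refl to ≼-refl; trans to ≼-trans)

    infix 4 _~_

    _~_ : Carrier → Carrier → Set
    _~_ = Assoc~ 𝒜 _≼_

    ~-isEquivalence : IsEquivalence _~_
    ~-isEquivalence = record
      { refl  = λ {x} → ≼-refl x , ≼-refl x
      ; sym   = λ (x≼y , y≼x) → y≼x , x≼y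
      ; trans = λ (x≼y , y≼x) (y≼z , z≼y) → ≼-trans x≼y y≼z , ≼-trans z≼y y≼x
      }

    open IsEquivalence ~-isEquivalence using () renaming (refl to ~-refl)

    ≼-preorder : Preorder _ _ _
    ≼-preorder = record
      { isPreorder = record
        { isEquivalence = ~-isEquivalence
        ; reflexive     = proj₁
        ; trans         = ≼-trans
        }
      }

    open import Relation.Binary.Reasoning.Preorder ≼-preorder
    open import Algebra.Definitions _~_
      using (Congruent₂; LeftCancellative; RightCancellative)

    ∙-cong : Congruent₂ _∙_
    ∙-cong (x≼y , y≼x) (u≼v , v≼u) = ∙-mono x≼y u≼v , ∙-mono y≼x v≼u

    ∙-cancelˡ : LeftCancellative _∙_
    ∙-cancelˡ x y z (p , q) = proj₂ cancellable y z x p , proj₂ cancellable z y x q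

    ∙-cancelʳ : RightCancellative _∙_
    ∙-cancelʳ x y z (p , q) = proj₁ cancellable y z x p , proj₁ cancellable z y x q

    absorbed⇒identity : ∀ {a b} → a ∙ b ~ a → b ∙ a ~ a → Identity _~_ b _∙_
    absorbed⇒identity {a} {b} ab~a ba~a = b-left , b-right
      where
      b-left : ∀ z → b ∙ z ~ z
      b-left z = ∙-cancelˡ a (b ∙ z) z (begin-equality
        a ∙ (b ∙ z)  ≡⟨ ∙-assoc a b z ⟨
        a ∙ b ∙ z    ≈⟨ ∙-cong ab~a ~-refl ⟩
        a ∙ z        ∎)

      b-right : ∀ z → z ∙ b ~ z
      b-right z = ∙-cancelʳ a (z ∙ b) z (begin-equality
        z ∙ b ∙ a    ≡⟨ ∙-assoc z b a ⟩
        z ∙ (b ∙ a)  ≈⟨ ∙-cong ~-refl ba~a ⟩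
        z ∙ a        ∎)

    repeated-power⇒identity : ∀ a i d →
      a ^[1+ i ] ~ a ^[1+ suc (i + d) ] → Identity _~_ (a ^[1+ d ]) _∙_
    repeated-power⇒identity a i d aⁱ~aʲ = absorbed⇒identity
      (begin-equality
        a ^[1+ i ] ∙ a ^[1+ d ]    ≡⟨ ^[1+]-homo-∙ a i d ⟨
        a ^[1+ suc (i + d) ]       ≈⟨ aⁱ~aʲ ⟨
        a ^[1+ i ]                 ∎)
      (begin-equality
        a ^[1+ d ] ∙ a ^[1+ i ]    ≡⟨ ^[1+]-homo-∙ a d i ⟨
        a ^[1+ suc (d + i) ]       ≡⟨ cong (λ n → a ^[1+ suc n ]) (+-comm d i) ⟩
        a ^[1+ suc (i + d) ]       ≈⟨ aⁱ~aʲ ⟨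
        a ^[1+ i ]                 ∎)

    finiteIndex⇒identity-power : FiniteIndex 𝒜 _≼_ →
      ∀ a → ∃[ d ] Identity _~_ (a ^[1+ d ]) _∙_
    finiteIndex⇒identity-power (n , r , class) a
      with i , j , i<j , same-class ← pigeonhole (n<1+n n) (λ k → proj₁ (class (a ^[1+ toℕ k ])))
      with d , i+1+d≡j ← m≤n⇒∃[o]m+o≡n i<j
      = d , repeated-power⇒identity a (toℕ i) d (begin-equality
        a ^[1+ toℕ i ]              ≈⟨ proj₂ (class (a ^[1+ toℕ i ])) ⟩
        r _                         ≡⟨ cong r same-class ⟩
        r _                         ≈⟨ proj₂ (class (a ^[1+ toℕ j ])) ⟨
        a ^[1+ toℕ j ]              ≡⟨ cong (a ^[1+_]) i+1+d≡j ⟨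
        a ^[1+ suc (toℕ i + d) ]    ∎)

    identity-unique : ∀ {e f} → Identity _~_ e _∙_ → Identity _~_ f _∙_ → e ~ f
    identity-unique {e} {f} (e-left , _) (_ , f-right) = begin-equality
      e      ≈⟨ f-right e ⟨
      e ∙ f  ≈⟨ e-left f ⟩
      f      ∎

    identity-square : ∀ {e} → Identity _~_ e _∙_ → Identity _~_ (e ∙ e) _∙_
    identity-square {e} (e-left , e-right) = ee-left , ee-right
      where
      ee-left : ∀ z → e ∙ e ∙ z ~ z
      ee-left z = begin-equality
        e ∙ e ∙ z    ≡⟨ ∙-assoc e e z ⟩
        e ∙ (e ∙ z)  ≈⟨ e-left (e ∙ z) ⟩
        e ∙ z        ≈⟨ e-left z ⟩
        z            ∎

      ee-right : ∀ z → z ∙ (e ∙ e) ~ z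
      ee-right z = begin-equality
        z ∙ (e ∙ e)  ≡⟨ ∙-assoc z e e ⟨
        z ∙ e ∙ e    ≈⟨ e-right (z ∙ e) ⟩
        z ∙ e        ≈⟨ e-right z ⟩
        z            ∎

    -- The inverse cannot be a^d (there is no a^0 when d = 0); a^(2d+1) works since a ∙ a^(2d+1) = e ∙ e for e = a^(1+d).
    identity-power⇒inverse : ∀ {a} → ∃[ d ] Identity _~_ (a ^[1+ d ]) _∙_ →
      ∃[ a⁻¹ ] Identity _~_ (a ∙ a⁻¹) _∙_
    identity-power⇒inverse {a} (d , e-identity) =
      a ^[1+ d + d ] ,
      subst (λ u → Identity _~_ u _∙_) (sym (^[1+]-homo-∙ a d d)) (identity-square e-identity)

    identity≼⇒≼-powers : ∀ {e h} → Identity _~_ e _∙_ → e ≼ h → ∀ k → h ≼ h ^[1+ k ]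
    identity≼⇒≼-powers {h = h} _ _ zero = ≼-refl h
    identity≼⇒≼-powers {e} {h} e-identity e≼h (suc k) = begin
      h               ≲⟨ identity≼⇒≼-powers e-identity e≼h k ⟩
      h ^[1+ k ]      ≈⟨ proj₁ e-identity (h ^[1+ k ]) ⟨
      e ∙ h ^[1+ k ]  ≲⟨ ∙-mono e≼h (≼-refl (h ^[1+ k ])) ⟩
      h ∙ h ^[1+ k ]  ∎

    identity≼⇒≼identity : ∀ {e h} → Identity _~_ e _∙_ → e ≼ h →
      ∃[ K ] Identity _~_ (h ^[1+ K ]) _∙_ → h ≼ e
    identity≼⇒≼identity {e} {h} e-identity e≼h (K , hᴷ-identity) = begin
      h           ≲⟨ identity≼⇒≼-powers e-identity e≼h K ⟩
      h ^[1+ K ]  ≈⟨ identity-unique hᴷ-identity e-identity ⟩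
      e           ∎

    identity-powers⇒≼-symmetric : (∀ a → ∃[ d ] Identity _~_ (a ^[1+ d ]) _∙_) →
      ∀ {x y} → x ≼ y → y ≼ x
    identity-powers⇒≼-symmetric identity-power {x} {y} x≼y
      with x⁻¹ , xx⁻¹-identity ← identity-power⇒inverse (identity-power x)
      = proj₁ cancellable y x x⁻¹ (identity≼⇒≼identity xx⁻¹-identity
          (∙-mono x≼y (≼-refl x⁻¹)) (identity-power (y ∙ x⁻¹)))

proposition5p4 : (𝒜 : SemigroupAlgebra) →
    (_≼_ : SemigroupAlgebra.Carrier 𝒜 → SemigroupAlgebra.Carrier 𝒜 → Set) →
    IsStable 𝒜 _≼_ → IsCancellable 𝒜 _≼_ → FiniteIndex 𝒜 _≼_ →
    (∀ x y → (x ≼ y → Assoc~ 𝒜 _≼_ x y) × (Assoc~ 𝒜 _≼_ x y → x ≼ y))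
proposition5p4 𝒜 _≼_ stable cancellable finite x y =
  (λ x≼y → x≼y , ≼-symmetric x≼y) , proj₁
  where
  open IsStable stable
  open CancellablePreorder 𝒜 _≼_ preorder ∙-mono cancellable
  ≼-symmetric : ∀ {x y} → x ≼ y → y ≼ x
  ≼-symmetric = identity-powers⇒≼-symmetric (finiteIndex⇒identity-power finite)
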